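{- Let $n\ge0$ be an integer, $\beta$ a complex number, and $H_n^\beta=F_nE^{n\beta}F_n^{ -1}$ acting on the space $\mathcal P_n$ of complex polynomials of degree at most $n$. Then $$H_n^{ -\beta}=J_n\,H_n^\beta\,J_n ,$$ where $J_n$ is the operator $x^p\mapsto x^{n-p}$ on $\mathcal P_n$.
   Context: $F_n$ is the linear operator on $\mathcal P_n$ with $F_n x^p=(1-x)^{2n+1}\sum_{m\ge0}m^p\binom{m+n}{n}x^m$, $p=0,\dots,n$ (a polynomial of degree $\le n$; $0^0=1$); it is invertible with $F_n^{ -1}x^p=\frac{n!}{(2n)!}(x)_p[x+n+1]_{n-p}$ (falling and rising factorials). $E^{c}$ is the shift $f(x)\mapsto f(x+c)$. -}

module Defs where

open import Level using (Level; suc; _⊔_)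
open import Algebra.Bundles using (CommutativeRing)
open import Algebra.Morphism.Structures using (module RingMorphisms)
open import Data.Nat as ℕ using (ℕ; zero; _!) renaming (suc to 1+; _+_ to _+ℕ_; _*_ to _*ℕ_; _∸_ to _∸ℕ_; _^_ to _^ℕ_)
open import Data.Nat.Properties using (_!≢0)
open import Data.Nat.Combinatorics using (_C_)
open import Data.Integer using (+_)
open import Data.Rational using (ℚ; _/_)
open import Data.Rational.Properties using (+-*-commutativeRing)
open import Data.Fin using (Fin; toℕ)
open import Data.List using (List; []; _∷_; foldr)
open import Data.List using () renaming (upTo to upToL)
open import Relation.Nullary using (does)
open import Data.Bool using (if_then_else_)

-- A commutative ring R together with a ring homomorphism ℚ → R
-- (i.e. a ℚ-algebra; ℂ is an instance).  The complex parameter β of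
-- the paper is taken in such an R.
record ℚAlgebra (c ℓ : Level) : Set (suc (c ⊔ ℓ)) where
  field
    commRing : CommutativeRing c ℓ
  open CommutativeRing commRing public
  field
    ι     : ℚ → Carrier
    ι-hom : RingMorphisms.IsRingHomomorphism
              (CommutativeRing.rawRing +-*-commutativeRing) rawRing ι

module Ops {c ℓ : Level} (A : ℚAlgebra c ℓ) where
  open ℚAlgebra A

  nat : ℕ → Carrier
  nat k = ι ((+ k) / 1)

  -- polynomials over R as coefficient lists (constant term first)
  Poly : Set c
  Poly = List Carrier

  _⊕_ : Poly → Poly → Poly
  [] ⊕ q = q
  (a ∷ p) ⊕ [] = a ∷ p
  (a ∷ p) ⊕ (b ∷ q) = (a + b) ∷ (p ⊕ q)

  scale : Carrier → Poly → Poly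
  scale a [] = []
  scale a (b ∷ q) = (a * b) ∷ scale a q

  _⊗_ : Poly → Poly → Poly
  [] ⊗ q = []
  (a ∷ p) ⊗ q = scale a q ⊕ (0# ∷ (p ⊗ q))

  one : Poly
  one = 1# ∷ []

  _⊗^_ : Poly → ℕ → Poly
  p ⊗^ zero = one
  p ⊗^ 1+ k = p ⊗ (p ⊗^ k)

  coeff : Poly → ℕ → Carrier
  coeff [] k = 0#
  coeff (a ∷ p) zero = a
  coeff (a ∷ p) (1+ k) = coeff p k

  xplus : Carrier → Poly
  xplus a = a ∷ 1# ∷ []

  prodP : ℕ → (ℕ → Poly) → Poly
  prodP zero f = one
  prodP (1+ k) f = prodP k f ⊗ f k

  sumP : ℕ → (ℕ → Poly) → Poly
  sumP zero f = []
  sumP (1+ k) f = sumP k f ⊕ f k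

  mono : Carrier → ℕ → Poly
  mono a zero = a ∷ []
  mono a (1+ m) = 0# ∷ mono a m

  -- F_n x^p = (1-x)^{2n+1} ∑_{m≥0} m^p C(m+n,n) x^m.
  -- Only coefficients of x^0..x^n are ever read off (the result has degree ≤ n),
  -- and those depend only on the terms with m ≤ n, so the series is truncated there.
  Fx : ℕ → ℕ → Poly
  Fx n p = ((1# ∷ (- 1#) ∷ []) ⊗^ (1+ (2 *ℕ n)))
           ⊗ sumP (1+ n) (λ m → mono (nat ((m ^ℕ p) *ℕ ((m +ℕ n) C n))) m)

  Finvx : ℕ → ℕ → Poly
  Finvx n p = scale (ι (((+ (n !)) / ((2 *ℕ n) !)) {{(2 *ℕ n) !≢0}}))
                (prodP p (λ i → xplus (- nat i))
                 ⊗ prodP (n ∸ℕ p) (λ i → xplus (nat (n +ℕ 1 +ℕ i))))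

  Ex : Carrier → ℕ → Poly
  Ex a p = xplus a ⊗^ p

  -- Matrices of operators on P_n in the monomial basis x^0..x^n:
  -- M i j = coefficient of x^i in the image of x^j.
  Mat : ℕ → Set c
  Mat n = Fin (1+ n) → Fin (1+ n) → Carrier

  matOf : (n : ℕ) → (ℕ → Poly) → Mat n
  matOf n T i j = coeff (T (toℕ j)) (toℕ i)

  sumFin : (n : ℕ) → (Fin n → Carrier) → Carrier
  sumFin zero f = 0#
  sumFin (1+ n) f = f Fin.zero + sumFin n (λ k → f (Fin.suc k))
    where import Data.Fin as Fin

  _∘M_ : {n : ℕ} → Mat n → Mat n → Mat n
  _∘M_ {n} S T i j = sumFin (1+ n) (λ k → S i k * T k j)

  Fmat Finvmat : (n : ℕ) → Mat n
  Fmat n = matOf n (Fx n)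
  Finvmat n = matOf n (Finvx n)

  Emat : (n : ℕ) → Carrier → Mat n
  Emat n a = matOf n (Ex a)

  H : (n : ℕ) → Carrier → Mat n
  H n β = Fmat n ∘M (Emat n (nat n * β) ∘M Finvmat n)

  J : (n : ℕ) → Mat n
  J n i j = if does (toℕ i +ℕ toℕ j ℕ.≟ n) then 1# else 0#

module Submission where

-- Write N = 2n+1 and u_t for the coefficient of x^t in (1-x)^N.  For a
-- function f, the coefficient of x^i in F_n f is
--     Fcoeff n i f = Σ_{a ≤ i} u_a C(i-a+n, n) f(i-a),
-- and the entry (i, j) of H_n^β equals Fcoeff n i (y ↦ G_j(nβ + y)), where
-- G_j is the polynomial F_n^{-1} x^j.  The proof rests on two reflections:
--  (1) for deg P ≤ n:  Fcoeff n i P = Fcoeff n (n-i) P̃,  P̃(y) = (-1)^n P(-y-n-1).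
--      Since n! C(m+n, n) = π(m) := (m+1)⋯(m+n), both sides are (up to n!) the
--      two outer blocks of the vanishing N-th finite difference Σ_{t ≤ N} u_t Q(i-t)
--      of Q = π·P (degree < N); the middle block vanishes at the roots of π, and
--      u_t = -u_{N-t} because N is odd.
--  (2) G_{n-j}(z) = (-1)^n G_j(-z-n-1), read off the product formula for F_n^{-1}.

open import Defs
open import Level using (Level)
open import Data.Nat using (ℕ)
open import Data.Fin using (Fin)
open import Data.Nat using () renaming (suc to 1+)

open import Algebra.Bundles using (CommutativeRing; Semiring)
open import Algebra.Morphism.Structures using (module RingMorphisms)
open import Algebra.Solver.Ring.AlmostCommutativeRing
  using (fromCommutativeRing; _-Raw-AlmostCommutative⟶_)
import Algebra.Definitions.RawSemiring as RawSemiringDefinitions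
import Algebra.Properties.Group as GroupProperties
import Algebra.Properties.Semiring.Exp as ExpProperties
open import Data.Bool using (if_then_else_)
import Data.Fin as F
import Data.Fin.Properties as FP
import Data.Integer as Z
import Data.Integer.Properties as ZP
open import Data.List using ([]; _∷_; length)
open import Data.Maybe using (Maybe; nothing; just)
import Data.Nat as N
import Data.Nat.Properties as NP
open import Data.Nat.Combinatorics
  using (_C_; nCk+nC[k+1]≡[n+1]C[k+1]; nC1≡n; nCk≡nC[n∸k])
import Data.Nat.Coprimality as Cop
open import Data.Nat.Solver using (module +-*-Solver)
open import Data.Rational as Q using (ℚ; mkℚ)
import Data.Rational.Properties as QP
open import Relation.Nullary using (yes; no; does; ¬_)
import Relation.Nullary.Decidable as Dec
import Relation.Binary.PropositionalEquality as Eq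
open Eq using (_≡_)
import Relation.Binary.Reasoning.Setoid as SetoidReasoning

nC0≡1 : ∀ n → n C 0 ≡ 1
nC0≡1 0 = Eq.refl
nC0≡1 (1+ n) = Eq.refl

C-absorb : ∀ a k → (1+ a C 1+ k) N.* 1+ k ≡ 1+ a N.* (a C k)
C-absorb 0 0 = Eq.refl
C-absorb 0 (1+ k) = Eq.refl
C-absorb (1+ a) 0 = Eq.trans (NP.*-identityʳ _) (Eq.trans (nC1≡n (1+ (1+ a))) (Eq.sym (NP.*-identityʳ _)))
C-absorb (1+ a) (1+ j) = begin
    (1+ (1+ a) C 1+ (1+ j)) N.* (2 N.+ j)
  ≡⟨ Eq.cong (N._* (2 N.+ j)) (Eq.sym (nCk+nC[k+1]≡[n+1]C[k+1] (1+ a) (1+ j))) ⟩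
    (x N.+ y) N.* (2 N.+ j)
  ≡⟨ solve 3 (λ x y j → (x :+ y) :* (con 2 :+ j) := (x :* (con 1 :+ j) :+ y :* (con 2 :+ j)) :+ x) Eq.refl x y j ⟩
    (x N.* 1+ j N.+ y N.* (2 N.+ j)) N.+ x
  ≡⟨ Eq.cong₂ (λ p q → (p N.+ q) N.+ x) (C-absorb a j) (C-absorb a (1+ j)) ⟩
    (1+ a N.* (a C j) N.+ 1+ a N.* (a C 1+ j)) N.+ x
  ≡⟨ Eq.cong (N._+ x) (Eq.sym (NP.*-distribˡ-+ (1+ a) (a C j) (a C 1+ j))) ⟩
    1+ a N.* (a C j N.+ a C 1+ j) N.+ x
  ≡⟨ Eq.cong (λ z → 1+ a N.* z N.+ x) (nCk+nC[k+1]≡[n+1]C[k+1] a j) ⟩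
    1+ a N.* x N.+ x
  ≡⟨ solve 2 (λ a x → (con 1 :+ a) :* x :+ x := (con 2 :+ a) :* x) Eq.refl a x ⟩
    1+ (1+ a) N.* x ∎
  where
  open Eq.≡-Reasoning
  open +-*-Solver
  x y : ℕ
  x = 1+ a C 1+ j
  y = 1+ a C (2 N.+ j)

-- The exponent 2n+1 of (1 - x) in the definition of F_n.
odd : ℕ → ℕ
odd n = 1+ (2 N.* n)

-- Index bookkeeping for splitting the range [0, 2n+1] at i and i+n (where i + i' = n).
outer-blocks-length : ∀ n i i' → i N.+ i' ≡ n → 1+ i N.+ (n N.+ 1+ i') ≡ 1+ (odd n)
outer-blocks-length _ i i' Eq.refl =
  solve 2 (λ i j → con 1 :+ i :+ ((i :+ j) :+ (con 1 :+ j)) := con 1 :+ (con 1 :+ con 2 :* (i :+ j))) Eq.refl i i'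
  where open +-*-Solver

-- The index a of the left block is paired with 1+i+n+m in the right block, m = i' - a.
reflected-index : ∀ n i a m → i N.+ (a N.+ m) ≡ n → a N.+ (1+ i N.+ (n N.+ m)) ≡ odd n
reflected-index _ i a m Eq.refl =
  solve 3 (λ i a m → a :+ (con 1 :+ i :+ ((i :+ (a :+ m)) :+ m)) := con 1 :+ con 2 :* (i :+ (a :+ m))) Eq.refl i a m
  where open +-*-Solver

module Development {c ℓ : Level} (A : ℚAlgebra c ℓ) where
  open ℚAlgebra A
  open Ops A
  open RawSemiringDefinitions (Semiring.rawSemiring semiring) using (_^_)
  open ExpProperties semiring using (^-congˡ)
  open GroupProperties +-group using (inverseˡ-unique; ε⁻¹≈ε)
  open SetoidReasoning setoid

  private
    module ιHom = RingMorphisms.IsRingHomomorphism ι-hom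

    ι-morphism : CommutativeRing.rawRing QP.+-*-commutativeRing
                   -Raw-AlmostCommutative⟶ fromCommutativeRing commRing
    ι-morphism = record
      { ⟦_⟧ = ι ; +-homo = ιHom.+-homo ; *-homo = ιHom.*-homo ; -‿homo = ιHom.-‿homo
      ; 0-homo = ιHom.0#-homo ; 1-homo = ιHom.1#-homo }

    ι-equal? : (a b : ℚ) → Maybe (ι a ≈ ι b)
    ι-equal? a b with a QP.≟ b
    ... | yes a≡b = just (reflexive (Eq.cong ι a≡b))
    ... | no _ = nothing

  open import Algebra.Solver.Ring (CommutativeRing.rawRing QP.+-*-commutativeRing)
    (fromCommutativeRing commRing) ι-morphism ι-equal? using (solve; _:=_; con; _:+_; _:*_; :-_)

  -- The solver sees the constants 0 and 1 of R only as images of rationals.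
  0≈ι0 : 0# ≈ ι Q.0ℚ
  0≈ι0 = sym ιHom.0#-homo

  1≈ι1 : 1# ≈ ι Q.1ℚ
  1≈ι1 = sym ιHom.1#-homo

  -0≈0 : - 0# ≈ 0#
  -0≈0 = ε⁻¹≈ε

  sum-zero⇒neg : ∀ {a b} → a + b ≈ 0# → a ≈ - b
  sum-zero⇒neg {a} {b} = inverseˡ-unique a b

  private
    ℚ-literal : ∀ k → (Z.+ k) Q./ 1 ≡ mkℚ (Z.+ k) 0 (Cop.sym (Cop.1-coprimeTo k))
    ℚ-literal k = QP.normalize-coprime _

  nat-+ : ∀ a b → nat (a N.+ b) ≈ nat a + nat b
  nat-+ a b = trans (reflexive (Eq.cong ι literal-+)) (ιHom.+-homo _ _)
    where
    literal-+ : (Z.+ (a N.+ b)) Q./ 1 ≡ (Z.+ a) Q./ 1 Q.+ (Z.+ b) Q./ 1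
    literal-+ rewrite ℚ-literal a | ℚ-literal b | ZP.*-identityʳ (Z.+ a) | ZP.*-identityʳ (Z.+ b) = Eq.refl

  nat-* : ∀ a b → nat (a N.* b) ≈ nat a * nat b
  nat-* a b = trans (reflexive (Eq.cong ι literal-*)) (ιHom.*-homo _ _)
    where
    literal-* : (Z.+ (a N.* b)) Q./ 1 ≡ ((Z.+ a) Q./ 1) Q.* ((Z.+ b) Q./ 1)
    literal-* rewrite ℚ-literal a | ℚ-literal b | ZP.+◃n≡+n (a N.* b) = Eq.refl

  nat-0 : nat 0 ≈ 0#
  nat-0 = ιHom.0#-homo

  nat-1 : nat 1 ≈ 1#
  nat-1 = ιHom.1#-homo

  nat-suc : ∀ a → nat (1+ a) ≈ 1# + nat a
  nat-suc a = trans (nat-+ 1 a) (+-congʳ nat-1)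

  nat-∸ : ∀ i a → a N.≤ i → nat (i N.∸ a) ≈ nat i + - nat a
  nat-∸ i a a≤i = begin
      nat (i N.∸ a)
    ≈⟨ solve 2 (λ m a → m := (m :+ a) :+ :- a) refl (nat (i N.∸ a)) (nat a) ⟩
      (nat (i N.∸ a) + nat a) + - nat a
    ≈⟨ +-congʳ (sym (nat-+ (i N.∸ a) a)) ⟩
      nat (i N.∸ a N.+ a) + - nat a
    ≡⟨ Eq.cong (λ z → nat z + - nat a) (NP.m∸n+n≡m a≤i) ⟩
      nat i + - nat a ∎

  nat-^ : ∀ m k → nat (m N.^ k) ≈ nat m ^ k
  nat-^ m 0 = nat-1
  nat-^ m (1+ k) = trans (nat-* m (m N.^ k)) (*-congˡ (nat-^ m k))

  -- n! is invertible in R, which lets us cancel the factor n! relating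
  -- binomial coefficients to rising factorials.
  inv! : ℕ → Carrier
  inv! n = ι (Q.1/_ (mkℚ (Z.+ (n N.!)) 0 (Cop.sym (Cop.1-coprimeTo (n N.!)))) {{n NP.!≢0}})

  inv!-cancel : ∀ n z → inv! n * (nat (n N.!) * z) ≈ z
  inv!-cancel n z = trans (sym (*-assoc _ _ _)) (trans (*-congʳ inv!-left) (*-identityˡ z))
    where
    q : ℚ
    q = mkℚ (Z.+ (n N.!)) 0 (Cop.sym (Cop.1-coprimeTo (n N.!)))
    inv!-left : inv! n * nat (n N.!) ≈ 1#
    inv!-left = begin
        inv! n * nat (n N.!)
      ≈⟨ *-congˡ (reflexive (Eq.cong ι (ℚ-literal (n N.!)))) ⟩
        inv! n * ι q
      ≈⟨ sym (ιHom.*-homo _ _) ⟩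
        ι (Q.1/_ q {{n NP.!≢0}} Q.* q)
      ≈⟨ reflexive (Eq.cong ι (QP.*-inverseˡ q {{n NP.!≢0}})) ⟩
        ι Q.1ℚ
      ≈⟨ ιHom.1#-homo ⟩
        1# ∎

  sign : ℕ → Carrier
  sign 0 = 1#
  sign (1+ k) = - sign k

  sign-+ : ∀ a b → sign (a N.+ b) ≈ sign a * sign b
  sign-+ 0 b = sym (*-identityˡ _)
  sign-+ (1+ a) b = trans (-‿cong (sign-+ a b)) (solve 2 (λ x y → :- (x :* y) := (:- x) :* y) refl _ _)

  sign-sq : ∀ a → sign a * sign a ≈ 1#
  sign-sq 0 = *-identityˡ 1#
  sign-sq (1+ a) = trans (solve 1 (λ x → (:- x) :* (:- x) := x :* x) refl _) (sign-sq a)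

  -- Powers of 1, needed to read Σ_t u_N(t) as the value of (1-x)^N at 1.
  1^k≈1 : ∀ k → 1# ^ k ≈ 1#
  1^k≈1 0 = refl
  1^k≈1 (1+ k) = trans (*-identityˡ _) (1^k≈1 k)

  Σ : ℕ → (ℕ → Carrier) → Carrier
  Σ 0 f = 0#
  Σ (1+ k) f = Σ k f + f k

  Σ-cong< : ∀ N {f g : ℕ → Carrier} → (∀ t → t N.< N → f t ≈ g t) → Σ N f ≈ Σ N g
  Σ-cong< 0 f≈g = refl
  Σ-cong< (1+ k) f≈g = +-cong (Σ-cong< k (λ t t<k → f≈g t (NP.m<n⇒m<1+n t<k))) (f≈g k NP.≤-refl)

  Σ-cong : ∀ N {f g : ℕ → Carrier} → (∀ t → f t ≈ g t) → Σ N f ≈ Σ N g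
  Σ-cong N f≈g = Σ-cong< N (λ t _ → f≈g t)

  Σ-vanish : ∀ N (f : ℕ → Carrier) → (∀ t → t N.< N → f t ≈ 0#) → Σ N f ≈ 0#
  Σ-vanish 0 f f≈0 = refl
  Σ-vanish (1+ k) f f≈0 =
    trans (+-cong (Σ-vanish k f (λ t t<k → f≈0 t (NP.m<n⇒m<1+n t<k))) (f≈0 k NP.≤-refl)) (+-identityˡ 0#)

  Σ-+ : ∀ N (f g : ℕ → Carrier) → Σ N (λ t → f t + g t) ≈ Σ N f + Σ N g
  Σ-+ 0 f g = sym (+-identityˡ 0#)
  Σ-+ (1+ k) f g = trans (+-congʳ (Σ-+ k f g))
    (solve 4 (λ a b x y → (a :+ b) :+ (x :+ y) := (a :+ x) :+ (b :+ y)) refl _ _ _ _)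

  Σ-*ˡ : ∀ N a (f : ℕ → Carrier) → a * Σ N f ≈ Σ N (λ t → a * f t)
  Σ-*ˡ 0 a f = zeroʳ a
  Σ-*ˡ (1+ k) a f = trans (distribˡ a _ _) (+-congʳ (Σ-*ˡ k a f))

  Σ-*ʳ : ∀ N a (f : ℕ → Carrier) → Σ N f * a ≈ Σ N (λ t → f t * a)
  Σ-*ʳ N a f = trans (*-comm _ a) (trans (Σ-*ˡ N a f) (Σ-cong N (λ t → *-comm a (f t))))

  Σ-neg : ∀ N (f : ℕ → Carrier) → - Σ N f ≈ Σ N (λ t → - f t)
  Σ-neg 0 f = -0≈0
  Σ-neg (1+ k) f = trans (solve 2 (λ a b → :- (a :+ b) := :- a :+ :- b) refl _ _) (+-congʳ (Σ-neg k f))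

  Σ-head : ∀ N (f : ℕ → Carrier) → Σ (1+ N) f ≈ f 0 + Σ N (λ t → f (1+ t))
  Σ-head 0 f = +-comm _ _
  Σ-head (1+ k) f = trans (+-congʳ (Σ-head k f)) (+-assoc _ _ _)

  Σ-split : ∀ M K (f : ℕ → Carrier) → Σ (M N.+ K) f ≈ Σ M f + Σ K (λ t → f (M N.+ t))
  Σ-split M 0 f = trans (reflexive (Eq.cong (λ z → Σ z f) (NP.+-identityʳ M))) (sym (+-identityʳ _))
  Σ-split M (1+ K) f = begin
      Σ (M N.+ 1+ K) f
    ≡⟨ Eq.cong (λ z → Σ z f) (NP.+-suc M K) ⟩
      Σ (M N.+ K) f + f (M N.+ K)
    ≈⟨ +-congʳ (Σ-split M K f) ⟩
      (Σ M f + Σ K (λ t → f (M N.+ t))) + f (M N.+ K)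
    ≈⟨ +-assoc _ _ _ ⟩
      Σ M f + (Σ K (λ t → f (M N.+ t)) + f (M N.+ K)) ∎

  Σ-reverse : ∀ N (f : ℕ → Carrier) → Σ N f ≈ Σ N (λ t → f (N N.∸ 1+ t))
  Σ-reverse 0 f = refl
  Σ-reverse (1+ k) f = begin
      Σ k f + f k
    ≈⟨ +-congʳ (Σ-reverse k f) ⟩
      Σ k (λ t → f (k N.∸ 1+ t)) + f k
    ≈⟨ +-comm _ _ ⟩
      f k + Σ k (λ t → f (k N.∸ 1+ t))
    ≈⟨ sym (Σ-head k (λ t → f (k N.∸ t))) ⟩
      Σ (1+ k) (λ t → f (k N.∸ t)) ∎

  Σ-swap : ∀ M K (f : ℕ → ℕ → Carrier) → Σ M (λ a → Σ K (λ b → f a b)) ≈ Σ K (λ b → Σ M (λ a → f a b))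
  Σ-swap 0 K f = sym (Σ-vanish K _ (λ _ _ → refl))
  Σ-swap (1+ M) K f = begin
      Σ M (λ a → Σ K (λ b → f a b)) + Σ K (λ b → f M b)
    ≈⟨ +-congʳ (Σ-swap M K f) ⟩
      Σ K (λ b → Σ M (λ a → f a b)) + Σ K (λ b → f M b)
    ≈⟨ sym (Σ-+ K _ _) ⟩
      Σ K (λ b → Σ M (λ a → f a b) + f M b) ∎

  Σ-single : ∀ N (g : ℕ → Carrier) m → m N.< N → (∀ t → t N.< N → ¬ (t ≡ m) → g t ≈ 0#) → Σ N g ≈ g m
  Σ-single (1+ k) g m m<1+k g≈0 with m NP.≟ k
  ... | yes Eq.refl =
    trans (+-congʳ (Σ-vanish k g (λ t t<k → g≈0 t (NP.m<n⇒m<1+n t<k) (λ t≡k → NP.<-irrefl t≡k t<k))))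
          (+-identityˡ _)
  ... | no m≢k =
    trans (+-cong (Σ-single k g m (NP.≤∧≢⇒< (NP.≤-pred m<1+k) m≢k) (λ t t<k → g≈0 t (NP.m<n⇒m<1+n t<k)))
                  (g≈0 k NP.≤-refl (λ k≡m → m≢k (Eq.sym k≡m))))
          (+-identityʳ _)

  Σ-drop-middle : ∀ i m j (T : ℕ → Carrier) → (∀ t → t N.< m → T (1+ i N.+ t) ≈ 0#) →
    Σ (1+ i N.+ (m N.+ 1+ j)) T ≈ Σ (1+ i) T + Σ (1+ j) (λ a → T (1+ i N.+ (m N.+ (j N.∸ a))))
  Σ-drop-middle i m j T middle≈0 = begin
      Σ (1+ i N.+ (m N.+ 1+ j)) T
    ≈⟨ Σ-split (1+ i) (m N.+ 1+ j) T ⟩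
      Σ (1+ i) T + Σ (m N.+ 1+ j) (λ t → T (1+ i N.+ t))
    ≈⟨ +-congˡ (Σ-split m (1+ j) (λ t → T (1+ i N.+ t))) ⟩
      Σ (1+ i) T + (Σ m (λ t → T (1+ i N.+ t)) + Σ (1+ j) (λ t → T (1+ i N.+ (m N.+ t))))
    ≈⟨ +-congˡ (trans (+-congʳ (Σ-vanish m _ middle≈0)) (+-identityˡ _)) ⟩
      Σ (1+ i) T + Σ (1+ j) (λ t → T (1+ i N.+ (m N.+ t)))
    ≈⟨ +-congˡ (Σ-reverse (1+ j) _) ⟩
      Σ (1+ i) T + Σ (1+ j) (λ a → T (1+ i N.+ (m N.+ (j N.∸ a)))) ∎

  Π : ℕ → (ℕ → Carrier) → Carrier
  Π 0 f = 1#
  Π (1+ k) f = Π k f * f k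

  Π-cong : ∀ N {f g : ℕ → Carrier} → (∀ t → t N.< N → f t ≈ g t) → Π N f ≈ Π N g
  Π-cong 0 f≈g = refl
  Π-cong (1+ k) f≈g = *-cong (Π-cong k (λ t t<k → f≈g t (NP.m<n⇒m<1+n t<k))) (f≈g k NP.≤-refl)

  Π-head : ∀ N (f : ℕ → Carrier) → Π (1+ N) f ≈ f 0 * Π N (λ t → f (1+ t))
  Π-head 0 f = *-comm _ _
  Π-head (1+ k) f = trans (*-congʳ (Π-head k f)) (*-assoc _ _ _)

  Π-reverse : ∀ N (f : ℕ → Carrier) → Π N f ≈ Π N (λ t → f (N N.∸ 1+ t))
  Π-reverse 0 f = refl
  Π-reverse (1+ k) f = begin
      Π k f * f k
    ≈⟨ *-congʳ (Π-reverse k f) ⟩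
      Π k (λ t → f (k N.∸ 1+ t)) * f k
    ≈⟨ *-comm _ _ ⟩
      f k * Π k (λ t → f (k N.∸ 1+ t))
    ≈⟨ sym (Π-head k (λ t → f (k N.∸ t))) ⟩
      Π (1+ k) (λ t → f (k N.∸ t)) ∎

  Π-vanish : ∀ N (f : ℕ → Carrier) s → s N.< N → f s ≈ 0# → Π N f ≈ 0#
  Π-vanish (1+ k) f s s<1+k fs≈0 with s NP.≟ k
  ... | yes Eq.refl = trans (*-congˡ fs≈0) (zeroʳ _)
  ... | no s≢k = trans (*-congʳ (Π-vanish k f s (NP.≤∧≢⇒< (NP.≤-pred s<1+k) s≢k) fs≈0)) (zeroˡ _)

  Π-neg : ∀ N (f : ℕ → Carrier) → Π N (λ t → - f t) ≈ sign N * Π N f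
  Π-neg 0 f = sym (*-identityˡ 1#)
  Π-neg (1+ k) f = trans (*-congʳ (Π-neg k f))
    (solve 3 (λ s p x → (s :* p) :* (:- x) := (:- s) :* (p :* x)) refl _ _ _)

  -- Polynomials: evaluation, coefficients and degree bounds
  -- (a coefficient list p has degree < K when length p ≤ K)

  eval : Poly → Carrier → Carrier
  eval [] y = 0#
  eval (a ∷ p) y = a + y * eval p y

  eval-cong : ∀ p {y z} → y ≈ z → eval p y ≈ eval p z
  eval-cong [] y≈z = refl
  eval-cong (a ∷ p) y≈z = +-congˡ (*-cong y≈z (eval-cong p y≈z))

  eval-⊕ : ∀ p q y → eval (p ⊕ q) y ≈ eval p y + eval q y
  eval-⊕ [] q y = sym (+-identityˡ _)
  eval-⊕ (a ∷ p) [] y = sym (+-identityʳ _)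
  eval-⊕ (a ∷ p) (b ∷ q) y = trans (+-congˡ (*-congˡ (eval-⊕ p q y)))
    (solve 5 (λ a b y u v → (a :+ b) :+ y :* (u :+ v) := (a :+ y :* u) :+ (b :+ y :* v)) refl a b y _ _)

  eval-scale : ∀ a p y → eval (scale a p) y ≈ a * eval p y
  eval-scale a [] y = sym (zeroʳ a)
  eval-scale a (b ∷ p) y = trans (+-congˡ (*-congˡ (eval-scale a p y)))
    (solve 4 (λ a b y u → a :* b :+ y :* (a :* u) := a :* (b :+ y :* u)) refl a b y _)

  eval-⊗ : ∀ p q y → eval (p ⊗ q) y ≈ eval p y * eval q y
  eval-⊗ [] q y = sym (zeroˡ _)
  eval-⊗ (a ∷ p) q y = begin
      eval (scale a q ⊕ (0# ∷ (p ⊗ q))) y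
    ≈⟨ eval-⊕ (scale a q) (0# ∷ (p ⊗ q)) y ⟩
      eval (scale a q) y + (0# + y * eval (p ⊗ q) y)
    ≈⟨ +-cong (eval-scale a q y) (+-cong 0≈ι0 (*-congˡ (eval-⊗ p q y))) ⟩
      a * eval q y + (ι Q.0ℚ + y * (eval p y * eval q y))
    ≈⟨ solve 4 (λ a u y v → a :* u :+ (con Q.0ℚ :+ y :* (v :* u)) := (a :+ y :* v) :* u) refl a (eval q y) y (eval p y) ⟩
      (a + y * eval p y) * eval q y ∎

  eval-one : ∀ y → eval one y ≈ 1#
  eval-one y = trans (+-cong 1≈ι1 (*-congˡ 0≈ι0))
    (trans (solve 1 (λ y → con Q.1ℚ :+ y :* con Q.0ℚ := con Q.1ℚ) refl y) (sym 1≈ι1))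

  eval-⊗^ : ∀ p k y → eval (p ⊗^ k) y ≈ eval p y ^ k
  eval-⊗^ p 0 y = eval-one y
  eval-⊗^ p (1+ k) y = trans (eval-⊗ p (p ⊗^ k) y) (*-congˡ (eval-⊗^ p k y))

  eval-xplus : ∀ a y → eval (xplus a) y ≈ a + y
  eval-xplus a y = trans (+-congˡ (*-congˡ (eval-one y))) (+-congˡ (*-identityʳ y))

  eval-prodP : ∀ k (f : ℕ → Carrier) y → eval (prodP k (λ t → xplus (f t))) y ≈ Π k (λ t → f t + y)
  eval-prodP 0 f y = eval-one y
  eval-prodP (1+ k) f y = trans (eval-⊗ (prodP k (λ t → xplus (f t))) (xplus (f k)) y)
    (*-cong (eval-prodP k f y) (eval-xplus (f k) y))

  coeff-⊕ : ∀ p q k → coeff (p ⊕ q) k ≈ coeff p k + coeff q k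
  coeff-⊕ [] q k = sym (+-identityˡ _)
  coeff-⊕ (a ∷ p) [] 0 = sym (+-identityʳ _)
  coeff-⊕ (a ∷ p) [] (1+ k) = sym (+-identityʳ _)
  coeff-⊕ (a ∷ p) (b ∷ q) 0 = refl
  coeff-⊕ (a ∷ p) (b ∷ q) (1+ k) = coeff-⊕ p q k

  coeff-scale : ∀ a p k → coeff (scale a p) k ≈ a * coeff p k
  coeff-scale a [] k = sym (zeroʳ a)
  coeff-scale a (b ∷ p) 0 = refl
  coeff-scale a (b ∷ p) (1+ k) = coeff-scale a p k

  coeff-⊗ : ∀ p q i → coeff (p ⊗ q) i ≈ Σ (1+ i) (λ a → coeff p a * coeff q (i N.∸ a))
  coeff-⊗ [] q i = sym (Σ-vanish (1+ i) _ (λ t _ → zeroˡ _))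
  coeff-⊗ (x ∷ p) q 0 = trans (coeff-⊕ (scale x q) (0# ∷ (p ⊗ q)) 0)
    (trans (+-congʳ (coeff-scale x q 0)) (+-comm _ _))
  coeff-⊗ (x ∷ p) q (1+ i) = begin
      coeff (scale x q ⊕ (0# ∷ (p ⊗ q))) (1+ i)
    ≈⟨ coeff-⊕ (scale x q) (0# ∷ (p ⊗ q)) (1+ i) ⟩
      coeff (scale x q) (1+ i) + coeff (p ⊗ q) i
    ≈⟨ +-cong (coeff-scale x q (1+ i)) (coeff-⊗ p q i) ⟩
      x * coeff q (1+ i) + Σ (1+ i) (λ a → coeff p a * coeff q (i N.∸ a))
    ≈⟨ sym (Σ-head (1+ i) (λ a → coeff (x ∷ p) a * coeff q (1+ i N.∸ a))) ⟩
      Σ (1+ (1+ i)) (λ a → coeff (x ∷ p) a * coeff q (1+ i N.∸ a)) ∎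

  coeff-linear⊗-0 : ∀ x₀ x₁ q → coeff ((x₀ ∷ x₁ ∷ []) ⊗ q) 0 ≈ x₀ * coeff q 0
  coeff-linear⊗-0 x₀ x₁ q = trans (coeff-⊕ (scale x₀ q) _ 0) (trans (+-identityʳ _) (coeff-scale x₀ q 0))

  coeff-linear⊗-suc : ∀ x₀ x₁ q t →
    coeff ((x₀ ∷ x₁ ∷ []) ⊗ q) (1+ t) ≈ x₀ * coeff q (1+ t) + x₁ * coeff q t
  coeff-linear⊗-suc x₀ x₁ q t = begin
      coeff ((x₀ ∷ x₁ ∷ []) ⊗ q) (1+ t)
    ≈⟨ coeff-⊕ (scale x₀ q) (0# ∷ ((x₁ ∷ []) ⊗ q)) (1+ t) ⟩
      coeff (scale x₀ q) (1+ t) + coeff (scale x₁ q ⊕ (0# ∷ [])) t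
    ≈⟨ +-cong (coeff-scale x₀ q (1+ t)) (coeff-⊕ (scale x₁ q) (0# ∷ []) t) ⟩
      x₀ * coeff q (1+ t) + (coeff (scale x₁ q) t + coeff (0# ∷ []) t)
    ≈⟨ +-congˡ (+-cong (coeff-scale x₁ q t) (coeff-zero t)) ⟩
      x₀ * coeff q (1+ t) + (x₁ * coeff q t + 0#)
    ≈⟨ +-congˡ (+-identityʳ _) ⟩
      x₀ * coeff q (1+ t) + x₁ * coeff q t ∎
    where
    coeff-zero : ∀ t → coeff (0# ∷ []) t ≈ 0#
    coeff-zero 0 = refl
    coeff-zero (1+ t) = refl

  coeff-sumP : ∀ M (f : ℕ → Poly) b → coeff (sumP M f) b ≈ Σ M (λ m → coeff (f m) b)
  coeff-sumP 0 f b = refl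
  coeff-sumP (1+ M) f b = trans (coeff-⊕ (sumP M f) (f M) b) (+-congʳ (coeff-sumP M f b))

  coeff-mono-≡ : ∀ a m → coeff (mono a m) m ≡ a
  coeff-mono-≡ a 0 = Eq.refl
  coeff-mono-≡ a (1+ m) = coeff-mono-≡ a m

  coeff-mono-≢ : ∀ a m b → ¬ (m ≡ b) → coeff (mono a m) b ≈ 0#
  coeff-mono-≢ a 0 0 0≢0 with 0≢0 Eq.refl
  ... | ()
  coeff-mono-≢ a 0 (1+ b) _ = refl
  coeff-mono-≢ a (1+ m) 0 _ = refl
  coeff-mono-≢ a (1+ m) (1+ b) m≢b = coeff-mono-≢ a m b (λ m≡b → m≢b (Eq.cong 1+ m≡b))

  eval-as-Σ : ∀ p N y → length p N.≤ N → eval p y ≈ Σ N (λ k → coeff p k * y ^ k)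
  eval-as-Σ [] N y _ = sym (Σ-vanish N _ (λ t _ → zeroˡ _))
  eval-as-Σ (a ∷ p) (1+ M) y (N.s≤s deg-p) = begin
      a + y * eval p y
    ≈⟨ +-cong (sym (*-identityʳ a)) (*-congˡ (eval-as-Σ p M y deg-p)) ⟩
      a * 1# + y * Σ M (λ k → coeff p k * y ^ k)
    ≈⟨ +-congˡ (Σ-*ˡ M y _) ⟩
      a * 1# + Σ M (λ k → y * (coeff p k * y ^ k))
    ≈⟨ +-congˡ (Σ-cong M (λ k → solve 3 (λ y u v → y :* (u :* v) := u :* (y :* v)) refl y (coeff p k) (y ^ k))) ⟩
      a * 1# + Σ M (λ k → coeff p k * (y * y ^ k))
    ≈⟨ sym (Σ-head M (λ k → coeff (a ∷ p) k * y ^ k)) ⟩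
      Σ (1+ M) (λ k → coeff (a ∷ p) k * y ^ k) ∎

  deg-⊕ : ∀ p q K → length p N.≤ K → length q N.≤ K → length (p ⊕ q) N.≤ K
  deg-⊕ [] q K _ deg-q = deg-q
  deg-⊕ (a ∷ p) [] K deg-p _ = deg-p
  deg-⊕ (a ∷ p) (b ∷ q) (1+ K) (N.s≤s deg-p) (N.s≤s deg-q) = N.s≤s (deg-⊕ p q K deg-p deg-q)

  length-scale : ∀ a p → length (scale a p) ≡ length p
  length-scale a [] = Eq.refl
  length-scale a (b ∷ p) = Eq.cong 1+ (length-scale a p)

  deg-⊗ : ∀ p q a b → length p N.≤ 1+ a → length q N.≤ 1+ b → length (p ⊗ q) N.≤ 1+ (a N.+ b)
  deg-⊗ [] q a b _ _ = N.z≤n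
  deg-⊗ (x ∷ []) q a b _ deg-q = deg-⊕ (scale x q) (0# ∷ []) _
    (Eq.subst (N._≤ 1+ (a N.+ b)) (Eq.sym (length-scale x q)) (NP.≤-trans deg-q (N.s≤s (NP.m≤n+m b a))))
    (N.s≤s N.z≤n)
  deg-⊗ (x ∷ y ∷ p) q (1+ a) b (N.s≤s deg-p) deg-q = deg-⊕ (scale x q) (0# ∷ ((y ∷ p) ⊗ q)) _
    (Eq.subst (N._≤ 1+ (1+ a N.+ b)) (Eq.sym (length-scale x q)) (NP.≤-trans deg-q (N.s≤s (NP.m≤n+m b (1+ a)))))
    (N.s≤s (deg-⊗ (y ∷ p) q a b deg-p deg-q))

  deg-linear^ : ∀ x₀ x₁ k → length ((x₀ ∷ x₁ ∷ []) ⊗^ k) N.≤ 1+ k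
  deg-linear^ x₀ x₁ 0 = NP.≤-refl
  deg-linear^ x₀ x₁ (1+ k) = deg-⊗ (x₀ ∷ x₁ ∷ []) ((x₀ ∷ x₁ ∷ []) ⊗^ k) 1 k NP.≤-refl (deg-linear^ x₀ x₁ k)

  deg-prodP : ∀ k (f : ℕ → Carrier) → length (prodP k (λ t → xplus (f t))) N.≤ 1+ k
  deg-prodP 0 f = NP.≤-refl
  deg-prodP (1+ k) f = Eq.subst (λ z → length (prodP (1+ k) (λ t → xplus (f t))) N.≤ 1+ z) (NP.+-comm k 1)
    (deg-⊗ (prodP k (λ t → xplus (f t))) (xplus (f k)) k 1 (deg-prodP k f) NP.≤-refl)

  shift : Poly → Carrier → Poly
  shift [] a = []
  shift (b ∷ p) a = (b ∷ []) ⊕ (shift p a ⊗ xplus a)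

  eval-shift : ∀ p a y → eval (shift p a) y ≈ eval p (a + y)
  eval-shift [] a y = refl
  eval-shift (b ∷ p) a y = begin
      eval ((b ∷ []) ⊕ (shift p a ⊗ xplus a)) y
    ≈⟨ eval-⊕ (b ∷ []) (shift p a ⊗ xplus a) y ⟩
      (b + y * 0#) + eval (shift p a ⊗ xplus a) y
    ≈⟨ +-cong (+-congˡ (*-congˡ 0≈ι0)) (eval-⊗ (shift p a) (xplus a) y) ⟩
      (b + y * ι Q.0ℚ) + eval (shift p a) y * eval (xplus a) y
    ≈⟨ +-congˡ (*-cong (eval-shift p a y) (eval-xplus a y)) ⟩
      (b + y * ι Q.0ℚ) + eval p (a + y) * (a + y)
    ≈⟨ solve 4 (λ b y w u → (b :+ y :* con Q.0ℚ) :+ u :* w := b :+ w :* u) refl b y (a + y) (eval p (a + y)) ⟩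
      b + (a + y) * eval p (a + y) ∎

  deg-shift : ∀ p a K → length p N.≤ K → length (shift p a) N.≤ K
  deg-shift [] a K deg-p = deg-p
  deg-shift (b ∷ []) a (1+ K) _ = N.s≤s N.z≤n
  deg-shift (b ∷ b' ∷ p) a (1+ (1+ K)) (N.s≤s deg-p) = deg-⊕ (b ∷ []) (shift (b' ∷ p) a ⊗ xplus a) _ (N.s≤s N.z≤n)
    (Eq.subst (λ z → length (shift (b' ∷ p) a ⊗ xplus a) N.≤ 1+ z) (NP.+-comm K 1)
      (deg-⊗ (shift (b' ∷ p) a) (xplus a) K 1 (deg-shift (b' ∷ p) a (1+ K) deg-p) NP.≤-refl))

  -- The coefficients u N t of (1 - x)^N and finite differences

  one-minus-x : Poly
  one-minus-x = 1# ∷ (- 1#) ∷ []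

  u : ℕ → ℕ → Carrier
  u N t = coeff (one-minus-x ⊗^ N) t

  u-binomial : ∀ N t → u N t ≈ sign t * nat (N C t)
  u-binomial 0 0 = sym (trans (*-identityˡ _) nat-1)
  u-binomial 0 (1+ t) = sym (trans (*-congˡ nat-0) (zeroʳ _))
  u-binomial (1+ N) 0 =
    trans (coeff-linear⊗-0 1# (- 1#) (one-minus-x ⊗^ N)) (trans (*-identityˡ _) (trans (u-binomial N 0) (*-congˡ (reflexive (Eq.cong nat (Eq.trans (nC0≡1 N) (Eq.sym (nC0≡1 (1+ N)))))))))
  u-binomial (1+ N) (1+ t) = begin
      u (1+ N) (1+ t)
    ≈⟨ coeff-linear⊗-suc 1# (- 1#) (one-minus-x ⊗^ N) t ⟩
      1# * u N (1+ t) + (- 1#) * u N t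
    ≈⟨ +-cong (*-cong 1≈ι1 (u-binomial N (1+ t))) (*-cong (-‿cong 1≈ι1) (u-binomial N t)) ⟩
      ι Q.1ℚ * (- sign t * nat (N C 1+ t)) + (- ι Q.1ℚ) * (sign t * nat (N C t))
    ≈⟨ solve 3 (λ s a b → con Q.1ℚ :* (:- s :* b) :+ (:- con Q.1ℚ) :* (s :* a) := (:- s) :* (a :+ b))
         refl (sign t) (nat (N C t)) (nat (N C 1+ t)) ⟩
      (- sign t) * (nat (N C t) + nat (N C 1+ t))
    ≈⟨ *-congˡ (sym (nat-+ (N C t) (N C 1+ t))) ⟩
      - sign t * nat (N C t N.+ N C 1+ t)
    ≡⟨ Eq.cong (λ z → - sign t * nat z) (nCk+nC[k+1]≡[n+1]C[k+1] N t) ⟩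
      sign (1+ t) * nat (1+ N C 1+ t) ∎

  u-absorb : ∀ M s → u (1+ M) (1+ s) * nat (1+ s) ≈ - (nat (1+ M) * u M s)
  u-absorb M s = begin
      u (1+ M) (1+ s) * nat (1+ s)
    ≈⟨ *-congʳ (u-binomial (1+ M) (1+ s)) ⟩
      (- sign s * nat (1+ M C 1+ s)) * nat (1+ s)
    ≈⟨ *-assoc _ _ _ ⟩
      - sign s * (nat (1+ M C 1+ s) * nat (1+ s))
    ≈⟨ *-congˡ (sym (nat-* (1+ M C 1+ s) (1+ s))) ⟩
      - sign s * nat ((1+ M C 1+ s) N.* 1+ s)
    ≡⟨ Eq.cong (λ z → - sign s * nat z) (C-absorb M s) ⟩
      - sign s * nat (1+ M N.* (M C s))
    ≈⟨ *-congˡ (nat-* (1+ M) (M C s)) ⟩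
      - sign s * (nat (1+ M) * nat (M C s))
    ≈⟨ solve 3 (λ g a b → (:- g) :* (a :* b) := :- (a :* (g :* b))) refl (sign s) (nat (1+ M)) (nat (M C s)) ⟩
      - (nat (1+ M) * (sign s * nat (M C s)))
    ≈⟨ -‿cong (*-congˡ (sym (u-binomial M s))) ⟩
      - (nat (1+ M) * u M s) ∎

  -- Σ_t u_N(t) = (1 - 1)^N = 0 for N ≥ 1.
  Σ-u : ∀ M → Σ (1+ (1+ M)) (u (1+ M)) ≈ 0#
  Σ-u M = begin
      Σ (1+ (1+ M)) (u (1+ M))
    ≈⟨ Σ-cong (1+ (1+ M)) (λ t → trans (sym (*-identityʳ _)) (*-congˡ (sym (1^k≈1 t)))) ⟩
      Σ (1+ (1+ M)) (λ t → u (1+ M) t * 1# ^ t)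
    ≈⟨ sym (eval-as-Σ (L ⊗^ 1+ M) (1+ (1+ M)) 1# (deg-linear^ 1# (- 1#) (1+ M))) ⟩
      eval (L ⊗^ 1+ M) 1#
    ≈⟨ eval-⊗^ L (1+ M) 1# ⟩
      eval L 1# * eval L 1# ^ M
    ≈⟨ *-congʳ L[1]≈0 ⟩
      0# * eval L 1# ^ M
    ≈⟨ zeroˡ _ ⟩
      0# ∎
    where
    L = one-minus-x
    L[1]≈0 : eval L 1# ≈ 0#
    L[1]≈0 = trans (+-cong 1≈ι1 (*-cong 1≈ι1 (+-cong (-‿cong 1≈ι1) (*-cong 1≈ι1 0≈ι0))))
      (trans (solve 0 (con Q.1ℚ :+ con Q.1ℚ :* (:- con Q.1ℚ :+ con Q.1ℚ :* con Q.0ℚ) := con Q.0ℚ) refl) (sym 0≈ι0))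

  difference-monomial : ∀ r N x → r N.< N → Σ (1+ N) (λ t → u N t * (x + - nat t) ^ r) ≈ 0#
  difference-monomial 0 (1+ M) x _ = trans (Σ-cong (1+ (1+ M)) (λ t → *-identityʳ _)) (Σ-u M)
  difference-monomial (1+ r) (1+ M) x (N.s≤s r<M) = begin
      Σ (1+ N) (λ t → u N t * ((x + - nat t) * h t))
    ≈⟨ Σ-cong (1+ N) (λ t → solve 4 (λ a x n h → a :* ((x :+ :- n) :* h) := x :* (a :* h) :+ :- (a :* n :* h))
         refl (u N t) x (nat t) (h t)) ⟩
      Σ (1+ N) (λ t → x * (u N t * h t) + - (u N t * nat t * h t))
    ≈⟨ Σ-+ (1+ N) _ _ ⟩
      Σ (1+ N) (λ t → x * (u N t * h t)) + Σ (1+ N) (λ t → - (u N t * nat t * h t))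
    ≈⟨ +-cong (sym (Σ-*ˡ (1+ N) x _)) (sym (Σ-neg (1+ N) _)) ⟩
      x * Σ (1+ N) (λ t → u N t * h t) + - Σ (1+ N) (λ t → u N t * nat t * h t)
    ≈⟨ +-cong (*-congˡ (difference-monomial r N x (NP.m<n⇒m<1+n r<M))) (-‿cong weighted≈0) ⟩
      x * 0# + - 0#
    ≈⟨ trans (+-cong (zeroʳ x) -0≈0) (+-identityˡ 0#) ⟩
      0# ∎
    where
    N = 1+ M
    h : ℕ → Carrier
    h t = (x + - nat t) ^ r
    x-1 = x + - 1#
    h-suc : ∀ s → h (1+ s) ≈ (x-1 + - nat s) ^ r
    h-suc s = ^-congˡ r (trans (+-congˡ (-‿cong (nat-suc s)))
      (solve 3 (λ x o n → x :+ :- (o :+ n) := (x :+ :- o) :+ :- n) refl x 1# (nat s)))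
    -- By absorption the weighted sum is -N times the M-th difference at x - 1.
    weighted≈0 : Σ (1+ N) (λ t → u N t * nat t * h t) ≈ 0#
    weighted≈0 = begin
        Σ (1+ N) (λ t → u N t * nat t * h t)
      ≈⟨ Σ-head N _ ⟩
        u N 0 * nat 0 * h 0 + Σ N (λ s → u N (1+ s) * nat (1+ s) * h (1+ s))
      ≈⟨ +-cong (trans (*-congʳ (trans (*-congˡ nat-0) (zeroʳ _))) (zeroˡ _))
                 (Σ-cong N (λ s → *-cong (u-absorb M s) (h-suc s))) ⟩
        0# + Σ N (λ s → - (nat N * u M s) * (x-1 + - nat s) ^ r)
      ≈⟨ +-identityˡ _ ⟩
        Σ N (λ s → - (nat N * u M s) * (x-1 + - nat s) ^ r)
      ≈⟨ Σ-cong N (λ s → solve 3 (λ a b c → (:- (a :* b)) :* c := :- (a :* (b :* c))) refl (nat N) (u M s) _) ⟩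
        Σ N (λ s → - (nat N * (u M s * (x-1 + - nat s) ^ r)))
      ≈⟨ sym (Σ-neg N _) ⟩
        - Σ N (λ s → nat N * (u M s * (x-1 + - nat s) ^ r))
      ≈⟨ -‿cong (sym (Σ-*ˡ N (nat N) _)) ⟩
        - (nat N * Σ (1+ M) (λ s → u M s * (x-1 + - nat s) ^ r))
      ≈⟨ -‿cong (trans (*-congˡ (difference-monomial r M x-1 r<M)) (zeroʳ _)) ⟩
        - 0#
      ≈⟨ -0≈0 ⟩
        0# ∎

  difference-poly : ∀ N Q x → length Q N.≤ N → Σ (1+ N) (λ t → u N t * eval Q (x + - nat t)) ≈ 0#
  difference-poly N Q x deg-Q = begin
      Σ (1+ N) (λ t → u N t * eval Q (z t))
    ≈⟨ Σ-cong (1+ N) (λ t → *-congˡ (eval-as-Σ Q N (z t) deg-Q)) ⟩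
      Σ (1+ N) (λ t → u N t * Σ N (λ r → coeff Q r * z t ^ r))
    ≈⟨ Σ-cong (1+ N) (λ t → trans (Σ-*ˡ N (u N t) _) (Σ-cong N (λ r →
         solve 3 (λ a b c → a :* (b :* c) := b :* (a :* c)) refl (u N t) (coeff Q r) (z t ^ r)))) ⟩
      Σ (1+ N) (λ t → Σ N (λ r → coeff Q r * (u N t * z t ^ r)))
    ≈⟨ Σ-swap (1+ N) N _ ⟩
      Σ N (λ r → Σ (1+ N) (λ t → coeff Q r * (u N t * z t ^ r)))
    ≈⟨ Σ-cong N (λ r → sym (Σ-*ˡ (1+ N) (coeff Q r) _)) ⟩
      Σ N (λ r → coeff Q r * Σ (1+ N) (λ t → u N t * z t ^ r))
    ≈⟨ Σ-vanish N _ (λ r r<N → trans (*-congˡ (difference-monomial r N x r<N)) (zeroʳ _)) ⟩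
      0# ∎
    where
    z : ℕ → Carrier
    z t = x + - nat t

  u-antisymmetric : ∀ n a b → a N.+ b ≡ odd n → u (odd n) a ≈ - u (odd n) b
  u-antisymmetric n a b a+b≡N = begin
      u (odd n) a
    ≈⟨ u-binomial (odd n) a ⟩
      sign a * nat (odd n C a)
    ≈⟨ *-cong sign-a (reflexive (Eq.cong nat C-sym)) ⟩
      (- sign b) * nat (odd n C b)
    ≈⟨ solve 2 (λ s c → (:- s) :* c := :- (s :* c)) refl (sign b) (nat (odd n C b)) ⟩
      - (sign b * nat (odd n C b))
    ≈⟨ -‿cong (sym (u-binomial (odd n) b)) ⟩
      - u (odd n) b ∎
    where
    b≡N∸a : b ≡ odd n N.∸ a
    b≡N∸a = Eq.trans (Eq.sym (NP.m+n∸m≡n a b)) (Eq.cong (N._∸ a) a+b≡N)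
    C-sym : odd n C a ≡ odd n C b
    C-sym = Eq.trans (nCk≡nC[n∸k] (Eq.subst (a N.≤_) a+b≡N (NP.m≤m+n a b))) (Eq.cong (odd n C_) (Eq.sym b≡N∸a))
    sign-odd : sign a * sign b ≈ - 1#
    sign-odd = begin
        sign a * sign b
      ≈⟨ sym (sign-+ a b) ⟩
        sign (a N.+ b)
      ≡⟨ Eq.cong sign (Eq.trans a+b≡N (Eq.cong (λ k → 1+ (n N.+ k)) (NP.+-identityʳ n))) ⟩
        - sign (n N.+ n)
      ≈⟨ -‿cong (trans (sign-+ n n) (sign-sq n)) ⟩
        - 1# ∎
    sign-a : sign a ≈ - sign b
    sign-a = begin
        sign a
      ≈⟨ sym (trans (*-congˡ (sign-sq b)) (*-identityʳ _)) ⟩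
        sign a * (sign b * sign b)
      ≈⟨ sym (*-assoc _ _ _) ⟩
        (sign a * sign b) * sign b
      ≈⟨ *-congʳ (trans sign-odd (-‿cong 1≈ι1)) ⟩
        (- ι Q.1ℚ) * sign b
      ≈⟨ solve 1 (λ s → (:- con Q.1ℚ) :* s := :- s) refl (sign b) ⟩
        - sign b ∎

  -- The rising factorial π n y = (y+1)(y+2)⋯(y+n)

  π : ℕ → Carrier → Carrier
  π n y = Π n (λ t → nat (1+ t) + y)

  risingP : ℕ → Poly
  risingP n = prodP n (λ t → xplus (nat (1+ t)))

  eval-risingP : ∀ n y → eval (risingP n) y ≈ π n y
  eval-risingP n = eval-prodP n (λ t → nat (1+ t))

  -- C(m+n, n) n! = (m+1)⋯(m+n): the binomial weights of F_n are polynomial in m.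
  π-binomial : ∀ n m → nat ((m N.+ n) C n) * nat (n N.!) ≈ π n (nat m)
  π-binomial 0 m = trans (*-congʳ (reflexive (Eq.cong nat (nC0≡1 (m N.+ 0))))) (trans (*-congʳ nat-1) (trans (*-identityˡ _) nat-1))
  π-binomial (1+ n) m = begin
      nat ((m N.+ 1+ n) C 1+ n) * nat (1+ n N.* (n N.!))
    ≡⟨ Eq.cong (λ z → nat (z C 1+ n) * nat (1+ n N.* (n N.!))) (NP.+-suc m n) ⟩
      nat (1+ (m N.+ n) C 1+ n) * nat (1+ n N.* (n N.!))
    ≈⟨ *-congˡ (nat-* (1+ n) (n N.!)) ⟩
      nat (1+ (m N.+ n) C 1+ n) * (nat (1+ n) * nat (n N.!))
    ≈⟨ sym (*-assoc _ _ _) ⟩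
      (nat (1+ (m N.+ n) C 1+ n) * nat (1+ n)) * nat (n N.!)
    ≈⟨ *-congʳ (sym (nat-* (1+ (m N.+ n) C 1+ n) (1+ n))) ⟩
      nat ((1+ (m N.+ n) C 1+ n) N.* 1+ n) * nat (n N.!)
    ≡⟨ Eq.cong (λ z → nat z * nat (n N.!)) (C-absorb (m N.+ n) n) ⟩
      nat (1+ (m N.+ n) N.* ((m N.+ n) C n)) * nat (n N.!)
    ≈⟨ *-congʳ (nat-* (1+ (m N.+ n)) ((m N.+ n) C n)) ⟩
      (nat (1+ (m N.+ n)) * nat ((m N.+ n) C n)) * nat (n N.!)
    ≈⟨ *-assoc _ _ _ ⟩
      nat (1+ (m N.+ n)) * (nat ((m N.+ n) C n) * nat (n N.!))
    ≈⟨ *-cong (trans (reflexive (Eq.cong (λ k → nat (1+ k)) (NP.+-comm m n))) (nat-+ (1+ n) m)) (π-binomial n m) ⟩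
      (nat (1+ n) + nat m) * π n (nat m)
    ≈⟨ *-comm _ _ ⟩
      π (1+ n) (nat m) ∎

  -- π n (-y-n-1) = (-1)^n π n y: the factors are permuted and negated.
  π-reflect : ∀ n y → π n (- y + - nat (1+ n)) ≈ sign n * π n y
  π-reflect n y = begin
      Π n (λ t → nat (1+ t) + w)
    ≈⟨ Π-reverse n _ ⟩
      Π n (λ t → nat (1+ (n N.∸ 1+ t)) + w)
    ≈⟨ Π-cong n factor ⟩
      Π n (λ t → - (nat (1+ t) + y))
    ≈⟨ Π-neg n _ ⟩
      sign n * π n y ∎
    where
    w = - y + - nat (1+ n)
    factor : ∀ t → t N.< n → nat (1+ (n N.∸ 1+ t)) + w ≈ - (nat (1+ t) + y)
    factor t t<n = begin
        a + (- y + - nat (1+ n))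
      ≈⟨ +-congˡ (+-congˡ (-‿cong (sym a+b≈n+1))) ⟩
        a + (- y + - (a + b))
      ≈⟨ solve 3 (λ a b y → a :+ (:- y :+ :- (a :+ b)) := :- (b :+ y)) refl a b y ⟩
        - (b + y) ∎
      where
      a = nat (1+ (n N.∸ 1+ t))
      b = nat (1+ t)
      a+b≈n+1 : a + b ≈ nat (1+ n)
      a+b≈n+1 = trans (sym (nat-+ (1+ (n N.∸ 1+ t)) (1+ t)))
        (reflexive (Eq.cong (λ k → nat (1+ k)) (NP.m∸n+n≡m t<n)))

  -- The coefficient functional of F_n and its reflection symmetry

  -- Fcoeff n i f = Σ_{a ≤ i} u_{2n+1}(a) C(i-a+n, n) f(i-a): the coefficient of
  -- x^i in (1-x)^{2n+1} Σ_m C(m+n, n) f(m) x^m.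
  Fcoeff : ℕ → ℕ → (Carrier → Carrier) → Carrier
  Fcoeff n i f = Σ (1+ i) (λ a → u (odd n) a * nat (((i N.∸ a) N.+ n) C n) * f (nat (i N.∸ a)))

  Fcoeff-cong : ∀ n i {f g : Carrier → Carrier} → (∀ y → f y ≈ g y) → Fcoeff n i f ≈ Fcoeff n i g
  Fcoeff-cong n i f≈g = Σ-cong (1+ i) (λ a → *-congˡ (f≈g _))

  reflect : ℕ → Poly → Carrier → Carrier
  reflect n P y = sign n * eval P (- y + - nat (1+ n))

  -- Fix n, i ≤ n and P of degree ≤ n; put i' = n - i and Q = π n · P, of degree < 2n+1.
  -- The terms T t = u(t) Q(i - t) of the vanishing (2n+1)-st difference of Q split into
  -- n! Fcoeff n i P (t ≤ i), zeros at the roots of π n (i < t ≤ i+n), and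
  -- -n! Fcoeff n i' P̃ (t > i+n).
  module Reflection (n i : ℕ) (P : Poly) (i≤n : i N.≤ n) (deg-P : length P N.≤ 1+ n) where
    i' : ℕ
    i' = n N.∸ i

    Q : Poly
    Q = risingP n ⊗ P

    x : Carrier
    x = nat i

    T : ℕ → Carrier
    T t = u (odd n) t * eval Q (x + - nat t)

    eval-Q : ∀ y → eval Q y ≈ π n y * eval P y
    eval-Q y = trans (eval-⊗ (risingP n) P y) (*-congʳ (eval-risingP n y))

    deg-Q : length Q N.≤ odd n
    deg-Q = Eq.subst (λ z → length Q N.≤ 1+ (n N.+ z)) (Eq.sym (NP.+-identityʳ n))
      (deg-⊗ (risingP n) P n n (deg-prodP n _) deg-P)

    i+i'≡n : i N.+ i' ≡ n
    i+i'≡n = NP.m+[n∸m]≡n i≤n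

    -- The right block, indexed from its end.
    T̃ : ℕ → Carrier
    T̃ a = T (1+ i N.+ (n N.+ (i' N.∸ a)))

    left-block : nat (n N.!) * Fcoeff n i (eval P) ≈ Σ (1+ i) T
    left-block = trans (Σ-*ˡ (1+ i) (nat (n N.!)) _) (Σ-cong< (1+ i) (λ a a<1+i → term a (NP.≤-pred a<1+i)))
      where
      term : ∀ a → a N.≤ i → nat (n N.!) * (u (odd n) a * nat (((i N.∸ a) N.+ n) C n) * eval P (nat (i N.∸ a))) ≈ T a
      term a a≤i = begin
          nat (n N.!) * (u (odd n) a * nat ((m N.+ n) C n) * eval P (nat m))
        ≈⟨ solve 4 (λ f v b e → f :* (v :* b :* e) := v :* ((b :* f) :* e)) refl _ _ _ _ ⟩
          u (odd n) a * ((nat ((m N.+ n) C n) * nat (n N.!)) * eval P (nat m))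
        ≈⟨ *-congˡ (trans (*-congʳ (π-binomial n m)) (sym (eval-Q (nat m)))) ⟩
          u (odd n) a * eval Q (nat m)
        ≈⟨ *-congˡ (eval-cong Q (nat-∸ i a a≤i)) ⟩
          T a ∎
        where m = i N.∸ a

    -- π n · P̃ is Q evaluated at the reflected point: the sign (-1)^n of P̃ is
    -- absorbed by reflecting π n.
    π-reflect-Q : ∀ y → π n y * reflect n P y ≈ eval Q (- y + - nat (1+ n))
    π-reflect-Q y = begin
        π n y * (sign n * eval P w)
      ≈⟨ solve 3 (λ p s e → p :* (s :* e) := (s :* p) :* e) refl _ _ _ ⟩
        (sign n * π n y) * eval P w
      ≈⟨ *-congʳ (sym (π-reflect n y)) ⟩
        π n w * eval P w
      ≈⟨ sym (eval-Q w) ⟩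
        eval Q w ∎
      where
      w : Carrier
      w = - y + - nat (1+ n)

    -- The reflected point -m-n-1 is i - k for the right-block index k = 1+i+n+m.
    reflected-point : ∀ m → - nat m + - nat (1+ n) ≈ x + - nat (1+ i N.+ (n N.+ m))
    reflected-point m = begin
        - nat m + - nat (1+ n)
      ≈⟨ +-congˡ (-‿cong (nat-suc n)) ⟩
        - nat m + - (1# + nat n)
      ≈⟨ solve 4 (λ x m n o → :- m :+ :- (o :+ n) := x :+ :- ((o :+ x) :+ (n :+ m))) refl x (nat m) (nat n) 1# ⟩
        x + - ((1# + x) + (nat n + nat m))
      ≈⟨ +-congˡ (-‿cong (sym (trans (nat-+ (1+ i) (n N.+ m)) (+-cong (nat-suc i) (nat-+ n m))))) ⟩
        x + - nat (1+ i N.+ (n N.+ m)) ∎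

    -- Up to n!, Fcoeff n i' P̃ is minus the block t > i+n, by the antisymmetry of u.
    right-block : nat (n N.!) * Fcoeff n i' (reflect n P) ≈ - Σ (1+ i') T̃
    right-block = trans (Σ-*ˡ (1+ i') (nat (n N.!)) _)
      (trans (Σ-cong< (1+ i') (λ a a<1+i' → term a (NP.≤-pred a<1+i'))) (sym (Σ-neg (1+ i') _)))
      where
      term : ∀ a → a N.≤ i' →
        nat (n N.!) * (u (odd n) a * nat (((i' N.∸ a) N.+ n) C n) * reflect n P (nat (i' N.∸ a))) ≈ - T̃ a
      term a a≤i' = begin
          nat (n N.!) * (u (odd n) a * nat ((m N.+ n) C n) * reflect n P (nat m))
        ≈⟨ solve 4 (λ f v b r → f :* (v :* b :* r) := v :* ((b :* f) :* r)) refl _ _ _ _ ⟩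
          u (odd n) a * ((nat ((m N.+ n) C n) * nat (n N.!)) * reflect n P (nat m))
        ≈⟨ *-congˡ (trans (*-congʳ (π-binomial n m)) (π-reflect-Q (nat m))) ⟩
          u (odd n) a * eval Q (- nat m + - nat (1+ n))
        ≈⟨ *-cong (u-antisymmetric n a k (reflected-index n i a m i+a+m≡n)) (eval-cong Q (reflected-point m)) ⟩
          (- u (odd n) k) * eval Q (x + - nat k)
        ≈⟨ solve 2 (λ v e → (:- v) :* e := :- (v :* e)) refl _ _ ⟩
          - T̃ a ∎
        where
        m k : ℕ
        m = i' N.∸ a
        k = 1+ i N.+ (n N.+ m)
        i+a+m≡n : i N.+ (a N.+ m) ≡ n
        i+a+m≡n = Eq.trans (Eq.cong (i N.+_) (NP.m+[n∸m]≡n a≤i')) i+i'≡n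

    -- Terms with i < t ≤ i+n vanish because π n has its roots at -1, …, -n.
    middle-block : ∀ t → t N.< n → T (1+ i N.+ t) ≈ 0#
    middle-block t t<n = begin
        u (odd n) (1+ i N.+ t) * eval Q y
      ≈⟨ *-congˡ (eval-Q y) ⟩
        u (odd n) (1+ i N.+ t) * (π n y * eval P y)
      ≈⟨ *-congˡ (*-congʳ (Π-vanish n _ t t<n root)) ⟩
        u (odd n) (1+ i N.+ t) * (0# * eval P y)
      ≈⟨ trans (*-congˡ (zeroˡ _)) (zeroʳ _) ⟩
        0# ∎
      where
      y = x + - nat (1+ i N.+ t)
      root : nat (1+ t) + y ≈ 0#
      root = begin
          nat (1+ t) + (x + - nat (1+ i N.+ t))
        ≡⟨ Eq.cong (λ z → nat (1+ t) + (x + - nat z)) (Eq.sym (NP.+-suc i t)) ⟩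
          nat (1+ t) + (x + - nat (i N.+ 1+ t))
        ≈⟨ +-congˡ (+-congˡ (-‿cong (nat-+ i (1+ t)))) ⟩
          nat (1+ t) + (x + - (x + nat (1+ t)))
        ≈⟨ solve 2 (λ b x → b :+ (x :+ :- (x :+ b)) := con Q.0ℚ) refl (nat (1+ t)) x ⟩
          ι Q.0ℚ
        ≈⟨ sym 0≈ι0 ⟩
          0# ∎

    -- The two outer blocks make up the whole vanishing difference.
    outer-blocks : Σ (1+ i) T + Σ (1+ i') T̃ ≈ 0#
    outer-blocks = begin
        Σ (1+ i) T + Σ (1+ i') T̃
      ≈⟨ sym (Σ-drop-middle i n i' T middle-block) ⟩
        Σ (1+ i N.+ (n N.+ 1+ i')) T
      ≡⟨ Eq.cong (λ z → Σ z T) (outer-blocks-length n i i' i+i'≡n) ⟩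
        Σ (1+ (odd n)) T
      ≈⟨ difference-poly (odd n) Q x deg-Q ⟩
        0# ∎

    Fcoeff-reflect : Fcoeff n i (eval P) ≈ Fcoeff n i' (reflect n P)
    Fcoeff-reflect = begin
        Fcoeff n i (eval P)
      ≈⟨ sym (inv!-cancel n _) ⟩
        inv! n * (nat (n N.!) * Fcoeff n i (eval P))
      ≈⟨ *-congˡ (trans left-block (sum-zero⇒neg outer-blocks)) ⟩
        inv! n * (- Σ (1+ i') T̃)
      ≈⟨ *-congˡ (sym right-block) ⟩
        inv! n * (nat (n N.!) * Fcoeff n i' (reflect n P))
      ≈⟨ inv!-cancel n _ ⟩
        Fcoeff n i' (reflect n P) ∎

  -- The basis F_n^{-1} x^p and its reflection symmetry

  G : ℕ → ℕ → Carrier → Carrier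
  G n p y = eval (Finvx n p) y

  κ : ℕ → Carrier
  κ n = ι (((Z.+ (n N.!)) Q./ ((2 N.* n) N.!)) {{(2 N.* n) NP.!≢0}})

  falling : ℕ → Carrier → Carrier
  falling k y = Π k (λ t → - nat t + y)

  shiftedRising : ℕ → ℕ → Carrier → Carrier
  shiftedRising n k y = Π k (λ t → nat (n N.+ 1 N.+ t) + y)

  fallingP : ℕ → Poly
  fallingP k = prodP k (λ t → xplus (- nat t))

  shiftedRisingP : ℕ → ℕ → Poly
  shiftedRisingP n k = prodP k (λ t → xplus (nat (n N.+ 1 N.+ t)))

  G-product : ∀ n p y → G n p y ≈ κ n * (falling p y * shiftedRising n (n N.∸ p) y)
  G-product n p y = trans (eval-scale (κ n) (fallingP p ⊗ shiftedRisingP n (n N.∸ p)) y)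
    (*-congˡ (trans (eval-⊗ (fallingP p) (shiftedRisingP n (n N.∸ p)) y)
      (*-cong (eval-prodP p (λ t → - nat t) y) (eval-prodP (n N.∸ p) (λ t → nat (n N.+ 1 N.+ t)) y))))

  deg-Finvx : ∀ n p → p N.≤ n → length (Finvx n p) N.≤ 1+ n
  deg-Finvx n p p≤n = Eq.subst (length (Finvx n p) N.≤_) (Eq.cong 1+ (NP.m+[n∸m]≡n p≤n))
    (Eq.subst (N._≤ 1+ (p N.+ (n N.∸ p))) (Eq.sym (length-scale (κ n) (fallingP p ⊗ shiftedRisingP n (n N.∸ p))))
      (deg-⊗ (fallingP p) (shiftedRisingP n (n N.∸ p)) p (n N.∸ p) (deg-prodP p _) (deg-prodP (n N.∸ p) _)))

  -- G_{n-j}(z) = (-1)^n G_j(-z-n-1): under y ↦ -y-n-1 the falling factors of one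
  -- basis polynomial become the (negated) rising factors of the other.
  G-reflect : ∀ n j z → j N.≤ n → G n (n N.∸ j) z ≈ reflect n (Finvx n j) z
  G-reflect n j z j≤n = begin
      G n (n N.∸ j) z
    ≈⟨ G-product n (n N.∸ j) z ⟩
      κ n * (falling (n N.∸ j) z * shiftedRising n (n N.∸ (n N.∸ j)) z)
    ≡⟨ Eq.cong (λ q → κ n * (falling (n N.∸ j) z * shiftedRising n q z)) (NP.m∸[m∸n]≡n j≤n) ⟩
      κ n * (falling j' z * shiftedRising n j z)
    ≈⟨ sym (*-identityˡ _) ⟩
      1# * (κ n * (falling j' z * shiftedRising n j z))
    ≈⟨ *-congʳ (sym (sign-sq n)) ⟩
      (sign n * sign n) * (κ n * (falling j' z * shiftedRising n j z))
    ≈⟨ *-congʳ (*-congˡ (sym sign-j+j')) ⟩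
      (sign n * (sign j * sign j')) * (κ n * (falling j' z * shiftedRising n j z))
    ≈⟨ solve 6 (λ S k a b s t → (S :* (s :* t)) :* (k :* (a :* b)) := S :* (k :* ((s :* b) :* (t :* a))))
         refl (sign n) (κ n) _ _ (sign j) (sign j') ⟩
      sign n * (κ n * ((sign j * shiftedRising n j z) * (sign j' * falling j' z)))
    ≈⟨ *-congˡ (*-congˡ (*-cong (sym (Π-neg j _)) (sym (Π-neg j' _)))) ⟩
      sign n * (κ n * (Π j (λ t → - (nat (n N.+ 1 N.+ t) + z)) * Π j' (λ t → - (- nat t + z))))
    ≈⟨ *-congˡ (*-congˡ (*-cong (Π-cong j (λ t _ → rising→falling t)) (Π-cong j' (λ t _ → falling→rising t)))) ⟩
      sign n * (κ n * (falling j w * shiftedRising n j' w))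
    ≈⟨ *-congˡ (sym (G-product n j w)) ⟩
      reflect n (Finvx n j) z ∎
    where
    j' = n N.∸ j
    w = - z + - nat (1+ n)
    sign-j+j' : sign j * sign j' ≈ sign n
    sign-j+j' = trans (sym (sign-+ j j')) (reflexive (Eq.cong sign (NP.m+[n∸m]≡n j≤n)))
    nat-n+1+t : ∀ t → nat (n N.+ 1 N.+ t) ≈ nat (1+ n) + nat t
    nat-n+1+t t = trans (nat-+ (n N.+ 1) t) (+-congʳ (reflexive (Eq.cong nat (NP.+-comm n 1))))
    rising→falling : ∀ t → - (nat (n N.+ 1 N.+ t) + z) ≈ - nat t + w
    rising→falling t = trans (-‿cong (+-congʳ (nat-n+1+t t)))
      (solve 3 (λ s t z → :- ((s :+ t) :+ z) := :- t :+ (:- z :+ :- s)) refl (nat (1+ n)) (nat t) z)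
    falling→rising : ∀ t → - (- nat t + z) ≈ nat (n N.+ 1 N.+ t) + w
    falling→rising t = trans (solve 3 (λ s t z → :- (:- t :+ z) := (s :+ t) :+ (:- z :+ :- s)) refl (nat (1+ n)) (nat t) z)
      (+-congʳ (sym (nat-n+1+t t)))

  reflect-shifted-basis : ∀ n b β y → b N.≤ n →
    reflect n (shift (Finvx n b) (nat n * - β)) y ≈ G n (n N.∸ b) (nat n * β + y)
  reflect-shifted-basis n b β y b≤n = begin
      sign n * eval (shift (Finvx n b) (nat n * - β)) (- y + - nat (1+ n))
    ≈⟨ *-congˡ (eval-shift (Finvx n b) (nat n * - β) _) ⟩
      sign n * G n b (nat n * - β + (- y + - nat (1+ n)))
    ≈⟨ *-congˡ (eval-cong (Finvx n b) (solve 4 (λ m b y s → m :* (:- b) :+ (:- y :+ :- s) := :- (m :* b :+ y) :+ :- s)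
         refl (nat n) β y (nat (1+ n)))) ⟩
      reflect n (Finvx n b) (nat n * β + y)
    ≈⟨ sym (G-reflect n b (nat n * β + y) b≤n) ⟩
      G n (n N.∸ b) (nat n * β + y) ∎

  -- The entries of H_n^β in terms of Fcoeff

  series : ℕ → ℕ → Poly
  series n p = sumP (1+ n) (λ m → mono (nat ((m N.^ p) N.* ((m N.+ n) C n))) m)

  coeff-series : ∀ n p b → b N.≤ n → coeff (series n p) b ≈ nat b ^ p * nat ((b N.+ n) C n)
  coeff-series n p b b≤n = begin
      coeff (series n p) b
    ≈⟨ coeff-sumP (1+ n) _ b ⟩
      Σ (1+ n) (λ m → coeff (mono (nat ((m N.^ p) N.* ((m N.+ n) C n))) m) b)
    ≈⟨ Σ-single (1+ n) _ b (N.s≤s b≤n) (λ t _ t≢b → coeff-mono-≢ _ t b t≢b) ⟩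
      coeff (mono (nat ((b N.^ p) N.* ((b N.+ n) C n))) b) b
    ≡⟨ coeff-mono-≡ _ b ⟩
      nat ((b N.^ p) N.* ((b N.+ n) C n))
    ≈⟨ trans (nat-* (b N.^ p) ((b N.+ n) C n)) (*-congʳ (nat-^ b p)) ⟩
      nat b ^ p * nat ((b N.+ n) C n) ∎

  coeff-Fx : ∀ n k a → a N.≤ n → coeff (Fx n k) a ≈ Σ (1+ a) (λ s → u (odd n) s * (nat (a N.∸ s) ^ k * nat (((a N.∸ s) N.+ n) C n)))
  coeff-Fx n k a a≤n = trans (coeff-⊗ (one-minus-x ⊗^ odd n) (series n k) a)
    (Σ-cong< (1+ a) (λ s _ → *-congˡ (coeff-series n k (a N.∸ s) (NP.≤-trans (NP.m∸n≤m a s) a≤n))))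

  EFinv : ℕ → Carrier → ℕ → ℕ → Carrier
  EFinv n c b k = Σ (1+ n) (λ l → coeff (Ex c l) k * coeff (Finvx n b) l)

  eval-EFinv : ∀ n c b y → b N.≤ n → Σ (1+ n) (λ k → y ^ k * EFinv n c b k) ≈ G n b (c + y)
  eval-EFinv n c b y b≤n = begin
      Σ (1+ n) (λ k → y ^ k * EFinv n c b k)
    ≈⟨ Σ-cong (1+ n) (λ k → trans (Σ-*ˡ (1+ n) (y ^ k) _) (Σ-cong (1+ n) (λ l →
         solve 3 (λ p e g → p :* (e :* g) := g :* (e :* p)) refl (y ^ k) (coeff (Ex c l) k) (coeff (Finvx n b) l)))) ⟩
      Σ (1+ n) (λ k → Σ (1+ n) (λ l → coeff (Finvx n b) l * (coeff (Ex c l) k * y ^ k)))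
    ≈⟨ Σ-swap (1+ n) (1+ n) _ ⟩
      Σ (1+ n) (λ l → Σ (1+ n) (λ k → coeff (Finvx n b) l * (coeff (Ex c l) k * y ^ k)))
    ≈⟨ Σ-cong< (1+ n) (λ l l<1+n → trans (sym (Σ-*ˡ (1+ n) _ _)) (*-congˡ (eval-Ex l l<1+n))) ⟩
      Σ (1+ n) (λ l → coeff (Finvx n b) l * (c + y) ^ l)
    ≈⟨ sym (eval-as-Σ (Finvx n b) (1+ n) (c + y) (deg-Finvx n b b≤n)) ⟩
      G n b (c + y) ∎
    where
    eval-Ex : ∀ l → l N.< 1+ n → Σ (1+ n) (λ k → coeff (Ex c l) k * y ^ k) ≈ (c + y) ^ l
    eval-Ex l l<1+n = begin
        Σ (1+ n) (λ k → coeff (Ex c l) k * y ^ k)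
      ≈⟨ sym (eval-as-Σ (Ex c l) (1+ n) y (NP.≤-trans (deg-linear^ c 1# l) l<1+n)) ⟩
        eval (Ex c l) y
      ≈⟨ trans (eval-⊗^ (xplus c) l y) (^-congˡ l (eval-xplus c y)) ⟩
        (c + y) ^ l ∎

  Hentry : ℕ → Carrier → ℕ → ℕ → Carrier
  Hentry n β a b = Σ (1+ n) (λ k → coeff (Fx n k) a * EFinv n (nat n * β) b k)

  Hentry-Fcoeff : ∀ n β a b → a N.≤ n → b N.≤ n → Hentry n β a b ≈ Fcoeff n a (λ y → G n b (nat n * β + y))
  Hentry-Fcoeff n β a b a≤n b≤n = begin
      Σ (1+ n) (λ k → coeff (Fx n k) a * V k)
    ≈⟨ Σ-cong (1+ n) (λ k → *-congʳ (coeff-Fx n k a a≤n)) ⟩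
      Σ (1+ n) (λ k → Σ (1+ a) (λ s → u (odd n) s * (y s ^ k * w s)) * V k)
    ≈⟨ Σ-cong (1+ n) (λ k → trans (Σ-*ʳ (1+ a) (V k) _) (Σ-cong (1+ a) (λ s →
         solve 4 (λ u p c v → u :* (p :* c) :* v := (u :* c) :* (p :* v)) refl (u (odd n) s) (y s ^ k) (w s) (V k)))) ⟩
      Σ (1+ n) (λ k → Σ (1+ a) (λ s → (u (odd n) s * w s) * (y s ^ k * V k)))
    ≈⟨ Σ-swap (1+ n) (1+ a) _ ⟩
      Σ (1+ a) (λ s → Σ (1+ n) (λ k → (u (odd n) s * w s) * (y s ^ k * V k)))
    ≈⟨ Σ-cong (1+ a) (λ s → trans (sym (Σ-*ˡ (1+ n) _ _)) (*-congˡ (eval-EFinv n (nat n * β) b (y s) b≤n))) ⟩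
      Fcoeff n a (λ y → G n b (nat n * β + y)) ∎
    where
    V = EFinv n (nat n * β) b
    y w : ℕ → Carrier
    y s = nat (a N.∸ s)
    w s = nat (((a N.∸ s) N.+ n) C n)

  sumFin-Σ : ∀ M (f : Fin M → Carrier) (g : ℕ → Carrier) → (∀ k → f k ≈ g (F.toℕ k)) → sumFin M f ≈ Σ M g
  sumFin-Σ 0 f g f≈g = refl
  sumFin-Σ (1+ M) f g f≈g =
    trans (+-cong (f≈g F.zero) (sumFin-Σ M (λ k → f (F.suc k)) (λ t → g (1+ t)) (λ k → f≈g (F.suc k))))
          (sym (Σ-head M g))

  H-Hentry : ∀ n β (i j : Fin (1+ n)) → H n β i j ≈ Hentry n β (F.toℕ i) (F.toℕ j)
  H-Hentry n β i j = sumFin-Σ (1+ n) _ _ (λ k → *-congˡ (sumFin-Σ (1+ n) _ _ (λ l → refl)))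

  -- Conjugation by J_n reverses both indices

  δ : ℕ → ℕ → Carrier
  δ x n = if does (x NP.≟ n) then 1# else 0#

  J-left : ∀ n a (g : ℕ → Carrier) → a N.≤ n → Σ (1+ n) (λ k → δ (a N.+ k) n * g k) ≈ g (n N.∸ a)
  J-left n a g a≤n =
    trans (Σ-single (1+ n) _ (n N.∸ a) (N.s≤s (NP.m∸n≤m n a)) off-diagonal)
          (trans (*-congʳ (reflexive (δ-yes (NP.m+[n∸m]≡n a≤n)))) (*-identityˡ _))
    where
    δ-yes : ∀ {x} → x ≡ n → δ x n ≡ 1#
    δ-yes x≡n = Eq.cong (λ b → if b then 1# else 0#) (Dec.dec-true (_ NP.≟ n) x≡n)
    δ-no : ∀ {x} → ¬ (x ≡ n) → δ x n ≡ 0#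
    δ-no x≢n = Eq.cong (λ b → if b then 1# else 0#) (Dec.dec-false (_ NP.≟ n) x≢n)
    off-diagonal : ∀ t → t N.< 1+ n → ¬ (t ≡ n N.∸ a) → δ (a N.+ t) n * g t ≈ 0#
    off-diagonal t _ t≢n∸a = trans (*-congʳ (reflexive (δ-no (λ a+t≡n →
      t≢n∸a (Eq.trans (Eq.sym (NP.m+n∸m≡n a t)) (Eq.cong (N._∸ a) a+t≡n)))))) (zeroˡ _)

  J-right : ∀ n b (g : ℕ → Carrier) → b N.≤ n → Σ (1+ n) (λ l → g l * δ (l N.+ b) n) ≈ g (n N.∸ b)
  J-right n b g b≤n =
    trans (Σ-cong (1+ n) (λ l → trans (*-comm _ _) (*-congʳ (reflexive (Eq.cong (λ z → δ z n) (NP.+-comm l b))))))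
          (J-left n b g b≤n)

  J-conjugate : ∀ n β (i j : Fin (1+ n)) →
    (J n ∘M (H n β ∘M J n)) i j ≈ Hentry n β (n N.∸ F.toℕ i) (n N.∸ F.toℕ j)
  J-conjugate n β i j = trans
    (sumFin-Σ (1+ n) _ _ (λ k → *-congˡ (trans
      (sumFin-Σ (1+ n) _ (λ l → Hentry n β (F.toℕ k) l * δ (l N.+ F.toℕ j) n) (λ l → *-congʳ (H-Hentry n β k l)))
      (J-right n (F.toℕ j) (Hentry n β (F.toℕ k)) (FP.toℕ≤pred[n] j)))))
    (J-left n (F.toℕ i) (λ k → Hentry n β k (n N.∸ F.toℕ j)) (FP.toℕ≤pred[n] i))

theorem18 : {c ℓ : Level} (A : ℚAlgebra c ℓ) (n : ℕ) (β : ℚAlgebra.Carrier A)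
    → (i j : Fin (1+ n))
    → ℚAlgebra._≈_ A (Ops.H A n (ℚAlgebra.-_ A β) i j)
    (Ops._∘M_ A (Ops.J A n) (Ops._∘M_ A (Ops.H A n β) (Ops.J A n)) i j)
theorem18 A n β i j = begin
    H n (- β) i j
  ≈⟨ H-Hentry n (- β) i j ⟩
    Hentry n (- β) a b
  ≈⟨ Hentry-Fcoeff n (- β) a b a≤n b≤n ⟩
    Fcoeff n a (λ y → G n b (nat n * - β + y))
  ≈⟨ Fcoeff-cong n a (λ y → sym (eval-shift (Finvx n b) (nat n * - β) y)) ⟩
    Fcoeff n a (eval P)
  ≈⟨ Reflection.Fcoeff-reflect n a P a≤n (deg-shift (Finvx n b) (nat n * - β) (1+ n) (deg-Finvx n b b≤n)) ⟩
    Fcoeff n (n N.∸ a) (reflect n P)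
  ≈⟨ Fcoeff-cong n (n N.∸ a) (λ y → reflect-shifted-basis n b β y b≤n) ⟩
    Fcoeff n (n N.∸ a) (λ y → G n (n N.∸ b) (nat n * β + y))
  ≈⟨ sym (Hentry-Fcoeff n β (n N.∸ a) (n N.∸ b) (NP.m∸n≤m n a) (NP.m∸n≤m n b)) ⟩
    Hentry n β (n N.∸ a) (n N.∸ b)
  ≈⟨ sym (J-conjugate n β i j) ⟩
    (J n ∘M (H n β ∘M J n)) i j ∎
  where
  open ℚAlgebra A
  open Ops A
  open Development A
  open SetoidReasoning setoid
  a b : ℕ
  a = F.toℕ i
  b = F.toℕ j
  a≤n : a N.≤ n
  a≤n = FP.toℕ≤pred[n] i
  b≤n : b N.≤ n
  b≤n = FP.toℕ≤pred[n] j
  P : Poly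
  P = shift (Finvx n b) (nat n * - β)
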